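{- Let $H=(\sigma_1,\dots,\sigma_m)$ be a sequence of moves of length $m=5n$ over a graph with $n$ vertices, and let $\mathcal{A}$ be the set of all arcs of $H$. Let $s=\lceil\log m\rceil$, $w=\lceil\sqrt{\log n}\rceil$, $t=\lceil s/w\rceil$. For $i\in[s]$ let $\mathcal{C}_i=\{\alpha\in\mathcal{A}:\mathrm{len}(\alpha)\in[2^{i-1}+1:2^i]\}$, and for $i\in[t]$ let $\mathcal{D}_i=\bigcup\{\mathcal{C}_j: (i-1)w+1\le j\le \min(iw,s)\}$; set $\mathcal{D}_0=\mathcal{D}_{t+1}=\emptyset$. Assume that $|\mathrm{good}(\mathcal{A})|\ge 0.99|\mathcal{A}|$. Then there exists $i^*\in[t]$ such that $$\frac{|\mathrm{good}(\mathcal{D}_{i^*})|}{|\mathcal{A}|}\ge\frac{1}{2t}\quad\text{and}\quad\frac{|\mathrm{good}(\mathcal{D}_{i^*})|}{|\mathcal{D}_{i^*-1}\cup\mathcal{D}_{i^*}\cup\mathcal{D}_{i^*+1}|}\ge\frac17.$$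
   Context: An arc of $H$ is a pair $\alpha=(i,j)$ with $i<j$, $\sigma_i=\sigma_j$, $\sigma_l\ne\sigma_i$ for $i<l<j$; $\mathrm{len}(\alpha)=j-i+1$. For $k\in[m]$, $\mathrm{pred}(k)$ is the largest $i<k$ with $\sigma_i=\sigma_k$ ($-\infty$ if none) and $\mathrm{succ}(k)$ is the smallest $j>k$ with $\sigma_j=\sigma_k$ ($+\infty$ if none); $\mathrm{leftradius}(k)=k-\mathrm{pred}(k)+1$ and $\mathrm{rightradius}(k)=\mathrm{succ}(k)-k+1$ (possibly $+\infty$). An arc $\alpha=(i,j)$ is good if $\min\{\mathrm{leftradius}(i),\mathrm{rightradius}(j)\}\ge\mathrm{len}(\alpha)/2^{\lceil\sqrt{\log n}\rceil}$, and bad otherwise; $\mathrm{good}(C)$ denotes the set of good arcs in $C$. Logarithms are base 2. -}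

module Defs where

open import Data.Nat using (ℕ; zero; suc; _+_; _*_; _∸_; _^_; _≤_; _<_; _⊓_; _≤?_; _<?_)
open import Data.Nat.Properties using (≤-trans; <⇒≤)
open import Data.Fin using (Fin; toℕ)
open import Data.Fin.Properties using (all?; any?; toℕ<n)
open import Data.List using (List; length; filter; cartesianProduct; allFin)
open import Data.Product using (Σ; _×_; _,_; proj₁; proj₂)
open import Data.Sum using (_⊎_)
open import Relation.Nullary using (¬_; Dec; yes; no)
open import Relation.Nullary.Decidable using (_×-dec_; _⊎-dec_; _→-dec_; ¬?; map′)
open import Relation.Unary using (Decidable)
open import Relation.Binary.Definitions using (DecidableEquality)
open import Relation.Binary.PropositionalEquality using (_≡_)

-- w = ⌈ √(log₂ n) ⌉ : the least natural w with √(log₂ n) ≤ w,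
-- i.e. log₂ n ≤ w², i.e. n ≤ 2^(w²).
IsCeilSqrtLog : ℕ → ℕ → Set
IsCeilSqrtLog n w = (n ≤ 2 ^ (w * w)) × (∀ v → v < w → 2 ^ (v * v) < n)

IsCeilDiv : ℕ → ℕ → ℕ → Set
IsCeilDiv s w t = (s ≤ t * w) × (∀ u → u < t → u * w < s)

-- Arcs of a move sequence H = σ : Fin m → M (positions 0..m-1 stand
-- for the paper's 1..m; only differences of positions matter).

Pair : ℕ → Set
Pair m = Fin m × Fin m

module _ {M : Set} {m : ℕ} (σ : Fin m → M) where

  IsArc : Pair m → Set
  IsArc (i , j) = (toℕ i < toℕ j) × (σ i ≡ σ j)
                  × (∀ l → toℕ i < toℕ l → toℕ l < toℕ j → ¬ (σ l ≡ σ i))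

  len : Pair m → ℕ
  len (i , j) = suc (toℕ j) ∸ toℕ i

  IsPred : Fin m → Fin m → Set
  IsPred k p = (toℕ p < toℕ k) × (σ p ≡ σ k)
               × (∀ l → toℕ p < toℕ l → toℕ l < toℕ k → ¬ (σ l ≡ σ k))

  IsSucc : Fin m → Fin m → Set
  IsSucc k q = (toℕ k < toℕ q) × (σ q ≡ σ k)
               × (∀ l → toℕ k < toℕ l → toℕ l < toℕ q → ¬ (σ l ≡ σ k))

  -- leftradius k ≥ L / 2^w   (leftradius k = k - pred k + 1, or ∞ if no pred)
  LeftRadiusGe : ℕ → Fin m → ℕ → Set
  LeftRadiusGe w k L = ∀ p → IsPred k p → L ≤ (toℕ k ∸ toℕ p + 1) * 2 ^ w

  -- rightradius k ≥ L / 2^w   (rightradius k = succ k - k + 1, or ∞ if no succ)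
  RightRadiusGe : ℕ → Fin m → ℕ → Set
  RightRadiusGe w k L = ∀ q → IsSucc k q → L ≤ (toℕ q ∸ toℕ k + 1) * 2 ^ w

  IsGoodArc : ℕ → Pair m → Set
  IsGoodArc w α = IsArc α × LeftRadiusGe w (proj₁ α) (len α) × RightRadiusGe w (proj₂ α) (len α)

  InC : ℕ → ℕ → Pair m → Set
  InC s j α = IsArc α × (1 ≤ j) × (j ≤ s) × (2 ^ (j ∸ 1) + 1 ≤ len α) × (len α ≤ 2 ^ j)

  -- α ∈ D_a : for a ∈ [t], the union of C_j over (a-1)w+1 ≤ j ≤ min(a w, s);
  -- empty for a ∉ [t] (in particular D_0 = D_{t+1} = ∅).
  InD : ℕ → ℕ → ℕ → ℕ → Pair m → Set
  InD s w t a α = (1 ≤ a) × (a ≤ t)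
                  × Σ ℕ (λ j → ((a ∸ 1) * w + 1 ≤ j) × (j ≤ (a * w) ⊓ s) × InC s j α)

module _ {M : Set} (_≟_ : DecidableEquality M) {m : ℕ} (σ : Fin m → M) where

  isArc? : Decidable (IsArc σ)
  isArc? (i , j) = (toℕ i <? toℕ j) ×-dec (σ i ≟ σ j)
    ×-dec all? (λ l → (toℕ i <? toℕ l) →-dec ((toℕ l <? toℕ j) →-dec ¬? (σ l ≟ σ i)))

  isPred? : ∀ k p → Dec (IsPred σ k p)
  isPred? k p = (toℕ p <? toℕ k) ×-dec (σ p ≟ σ k)
    ×-dec all? (λ l → (toℕ p <? toℕ l) →-dec ((toℕ l <? toℕ k) →-dec ¬? (σ l ≟ σ k)))

  isSucc? : ∀ k q → Dec (IsSucc σ k q)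
  isSucc? k q = (toℕ k <? toℕ q) ×-dec (σ q ≟ σ k)
    ×-dec all? (λ l → (toℕ k <? toℕ l) →-dec ((toℕ l <? toℕ q) →-dec ¬? (σ l ≟ σ k)))

  isGoodArc? : ∀ w → Decidable (IsGoodArc σ w)
  isGoodArc? w α = isArc? α
    ×-dec all? (λ p → isPred? (proj₁ α) p →-dec (len σ α ≤? (toℕ (proj₁ α) ∸ toℕ p + 1) * 2 ^ w))
    ×-dec all? (λ q → isSucc? (proj₂ α) q →-dec (len σ α ≤? (toℕ q ∸ toℕ (proj₂ α) + 1) * 2 ^ w))

  inC? : ∀ s j → Decidable (InC σ s j)
  inC? s j α = isArc? α ×-dec (1 ≤? j) ×-dec (j ≤? s)
    ×-dec (2 ^ (j ∸ 1) + 1 ≤? len σ α) ×-dec (len σ α ≤? 2 ^ j)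

  private
    boundedΣ? : (s : ℕ) (P : ℕ → Set) → (∀ j → P j → j ≤ s) → (∀ j → Dec (P j)) → Dec (Σ ℕ P)
    boundedΣ? s P bd P? = map′ (λ (f , p) → toℕ f , p)
                               (λ (j , p) → Data.Fin.fromℕ< {j} {suc s} (Data.Nat.s≤s (bd j p)) , subst-back j p)
                               (any? (λ (f : Fin (suc s)) → P? (toℕ f)))
      where
      open import Data.Fin.Properties using (toℕ-fromℕ<)
      open import Relation.Binary.PropositionalEquality using (subst; sym)
      subst-back : ∀ j (p : P j) → P (toℕ (Data.Fin.fromℕ< {j} {suc s} (Data.Nat.s≤s (bd j p))))
      subst-back j p = subst P (sym (toℕ-fromℕ< (Data.Nat.s≤s (bd j p)))) p

  inD? : ∀ s w t a → Decidable (InD σ s w t a)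
  inD? s w t a α = (1 ≤? a) ×-dec (a ≤? t)
    ×-dec boundedΣ? s _ (λ j x → proj₁ (proj₂ (proj₂ (proj₂ (proj₂ x)))))
            (λ j → (((a ∸ 1) * w + 1) ≤? j) ×-dec (j ≤? (a * w) ⊓ s) ×-dec inC? s j α)

card : {m : ℕ} {P : Pair m → Set} → Decidable P → ℕ
card {m} P? = length (filter P? (cartesianProduct (allFin m) (allFin m)))

module Submission where

-- The blocks D_1, …, D_t partition the arcs: every arc has length in
-- [2, m] ⊆ [2, 2^s], hence lies in exactly one dyadic class C_j and
-- exactly one block D_a.  Double counting then gives
--   Σ_a |good(D_a)| ≥ |good(A)| ≥ 0.99 |A|   and
--   Σ_a |D_{a-1} ∪ D_a ∪ D_{a+1}| ≤ 3 |A|.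
-- Put f a = 7|A| + 2t |D_{a-1} ∪ D_a ∪ D_{a+1}| and h a = 14t |good(D_a)| + 1.
-- The two bounds give Σ_a f a ≤ 13t|A| < 14t · 0.99|A| + t ≤ Σ_a h a, so some
-- block a has f a < h a, which yields both inequalities of the lemma at once.

open import Defs
open import Data.Nat using (ℕ; zero; suc; _+_; _*_; _∸_; _≤_; _<_; _^_; z≤n; s≤s; ⌈_/2⌉)
open import Data.Nat.Properties
open import Data.Nat.Logarithm using (⌈log₂_⌉; ⌈log₂⌉-mono-≤)
open import Data.Nat.Logarithm.Core using (⌈log2⌉)
open import Data.Nat.Induction using (<-wellFounded)
open import Induction.WellFounded using (Acc; acc)
open import Data.Nat.Tactic.RingSolver using (solve-∀)
open import Data.Fin using (Fin; toℕ)
open import Data.Fin.Properties using (toℕ<n)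
open import Data.List using (List; []; _∷_; length; filter; cartesianProduct; allFin)
open import Data.Product using (Σ; _×_; _,_; proj₁; proj₂)
open import Data.Sum using (_⊎_; inj₁; inj₂)
open import Data.Empty using (⊥-elim)
open import Relation.Nullary using (¬_; Dec; yes; no)
open import Relation.Nullary.Decidable using (_×-dec_; _⊎-dec_)
open import Relation.Unary using (Decidable)
open import Relation.Binary.Definitions using (DecidableEquality; tri<; tri≈; tri>)
open import Relation.Binary.PropositionalEquality using (_≡_; refl; sym; trans; cong; cong₂; subst; module ≡-Reasoning)

sumTo : ℕ → (ℕ → ℕ) → ℕ
sumTo zero    f = 0
sumTo (suc t) f = sumTo t f + f (suc t)

InRange : ℕ → ℕ → Set
InRange t i = (1 ≤ i) × (i ≤ t)

sumTo-+ : ∀ t f g → sumTo t (λ i → f i + g i) ≡ sumTo t f + sumTo t g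
sumTo-+ zero    f g = refl
sumTo-+ (suc t) f g =
  trans (cong (_+ (f (suc t) + g (suc t))) (sumTo-+ t f g))
        (interchange (sumTo t f) (sumTo t g) (f (suc t)) (g (suc t)))
  where
  interchange : ∀ a b c d → (a + b) + (c + d) ≡ (a + c) + (b + d)
  interchange = solve-∀

sumTo-cong : ∀ t {f g} → (∀ i → f i ≡ g i) → sumTo t f ≡ sumTo t g
sumTo-cong zero    f≡g = refl
sumTo-cong (suc t) f≡g = cong₂ _+_ (sumTo-cong t f≡g) (f≡g (suc t))

sumTo-* : ∀ t c f → sumTo t (λ i → c * f i) ≡ c * sumTo t f
sumTo-* zero    c f = sym (*-zeroʳ c)
sumTo-* (suc t) c f =
  trans (cong (_+ c * f (suc t)) (sumTo-* t c f)) (sym (*-distribˡ-+ c (sumTo t f) (f (suc t))))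

sumTo-const : ∀ t c → sumTo t (λ _ → c) ≡ t * c
sumTo-const zero    c = refl
sumTo-const (suc t) c = trans (cong (_+ c) (sumTo-const t c)) (+-comm (t * c) c)

sumTo-mono : ∀ t f g → (∀ i → InRange t i → f i ≤ g i) → sumTo t f ≤ sumTo t g
sumTo-mono zero    f g f≤g = z≤n
sumTo-mono (suc t) f g f≤g =
  +-mono-≤ (sumTo-mono t f g (λ i (1≤i , i≤t) → f≤g i (1≤i , m≤n⇒m≤1+n i≤t)))
           (f≤g (suc t) (s≤s z≤n , ≤-refl))

term≤sumTo : ∀ t f a → InRange t a → f a ≤ sumTo t f
term≤sumTo zero    f a (s≤s _ , ())
term≤sumTo (suc t) f a (1≤a , a≤1+t) with m≤n⇒m<n∨m≡n a≤1+t
... | inj₁ (s≤s a≤t) = ≤-trans (term≤sumTo t f a (1≤a , a≤t)) (m≤m+n (sumTo t f) (f (suc t)))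
... | inj₂ refl      = m≤n+m (f (suc t)) (sumTo t f)

sumTo-vanish : ∀ t f → (∀ i → InRange t i → f i ≡ 0) → sumTo t f ≡ 0
sumTo-vanish t f f≡0 = n≤0⇒n≡0
  (≤-trans (sumTo-mono t f (λ _ → 0) (λ i r → ≤-reflexive (f≡0 i r)))
           (≤-reflexive (trans (sumTo-const t 0) (*-zeroʳ t))))

sumTo-<-term : ∀ t f h → sumTo t f < sumTo t h → Σ ℕ λ i → InRange t i × (f i < h i)
sumTo-<-term zero    f h ()
sumTo-<-term (suc t) f h Sf<Sh with f (suc t) <? h (suc t)
... | yes last< = suc t , (s≤s z≤n , ≤-refl) , last<
... | no  last≮ =
  let (i , (1≤i , i≤t) , fi<hi) =
        sumTo-<-term t f h (+-cancelʳ-< (f (suc t)) (sumTo t f) (sumTo t h)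
                             (<-≤-trans Sf<Sh (+-monoʳ-≤ (sumTo t h) (≮⇒≥ last≮))))
  in i , (1≤i , m≤n⇒m≤1+n i≤t) , fi<hi

ind : {A : Set} → Dec A → ℕ
ind (yes _) = 1
ind (no  _) = 0

ind-yes : {A : Set} (d : Dec A) → A → ind d ≡ 1
ind-yes (yes _) _ = refl
ind-yes (no ¬a) a = ⊥-elim (¬a a)

ind-no : {A : Set} (d : Dec A) → ¬ A → ind d ≡ 0
ind-no (yes a) ¬a = ⊥-elim (¬a a)
ind-no (no  _) _  = refl

ind≤ : {A : Set} (d : Dec A) {r : ℕ} → (A → 1 ≤ r) → ind d ≤ r
ind≤ (yes a) 1≤r = 1≤r a
ind≤ (no  _) _   = z≤n

ind-⊎ : {A B : Set} (a? : Dec A) (b? : Dec B) → ind (a? ⊎-dec b?) ≤ ind a? + ind b?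
ind-⊎ (yes _) _       = s≤s z≤n
ind-⊎ (no  _) (yes _) = ≤-refl
ind-⊎ (no  _) (no  _) = z≤n

sumTo-ind-unique : {Q : Set} {P : ℕ → Set} (Q? : Dec Q) (P? : ∀ i → Dec (P i)) →
                   (∀ i → P i → Q) → (∀ i j → P i → P j → i ≡ j) →
                   ∀ t → sumTo t (λ i → ind (P? i)) ≤ ind Q?
sumTo-ind-unique Q? P? P⇒Q unique zero = z≤n
sumTo-ind-unique Q? P? P⇒Q unique (suc t) with P? (suc t)
... | yes p = ≤-reflexive (begin
  sumTo t (λ i → ind (P? i)) + 1 ≡⟨ cong (_+ 1) (sumTo-vanish t _ no-earlier) ⟩
  1                               ≡⟨ sym (ind-yes Q? (P⇒Q (suc t) p)) ⟩
  ind Q?                          ∎)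
  where
  open ≡-Reasoning
  no-earlier : ∀ i → InRange t i → ind (P? i) ≡ 0
  no-earlier i (_ , i≤t) = ind-no (P? i) λ pi → <-irrefl (unique i (suc t) pi p) (s≤s i≤t)
... | no _ = ≤-trans (≤-reflexive (+-identityʳ _)) (sumTo-ind-unique Q? P? P⇒Q unique t)

count : {A : Set} {P : A → Set} → Decidable P → List A → ℕ
count P? xs = length (filter P? xs)

count-∷ : {A : Set} {P : A → Set} (P? : Decidable P) (x : A) (xs : List A) →
          count P? (x ∷ xs) ≡ ind (P? x) + count P? xs
count-∷ P? x xs with P? x
... | yes _ = refl
... | no  _ = refl

module DoubleCounting {A : Set} {P : ℕ → A → Set} (P? : ∀ i → Decidable (P i)) (t : ℕ) where

  sumTo-count-∷ : ∀ x xs → sumTo t (λ i → count (P? i) (x ∷ xs))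
                           ≡ sumTo t (λ i → ind (P? i x)) + sumTo t (λ i → count (P? i) xs)
  sumTo-count-∷ x xs = trans (sumTo-cong t (λ i → count-∷ (P? i) x xs)) (sumTo-+ t _ _)

  count-family-≤ : {Q : A → Set} (Q? : Decidable Q) (c : ℕ) →
                   (∀ x → sumTo t (λ i → ind (P? i x)) ≤ c * ind (Q? x)) →
                   ∀ xs → sumTo t (λ i → count (P? i) xs) ≤ c * count Q? xs
  count-family-≤ Q? c bound [] = ≤-reflexive (trans (sumTo-const t 0) (trans (*-zeroʳ t) (sym (*-zeroʳ c))))
  count-family-≤ Q? c bound (x ∷ xs) = begin
    sumTo t (λ i → count (P? i) (x ∷ xs))                         ≡⟨ sumTo-count-∷ x xs ⟩
    sumTo t (λ i → ind (P? i x)) + sumTo t (λ i → count (P? i) xs) ≤⟨ +-mono-≤ (bound x) (count-family-≤ Q? c bound xs) ⟩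
    c * ind (Q? x) + c * count Q? xs                               ≡⟨ sym (*-distribˡ-+ c _ _) ⟩
    c * (ind (Q? x) + count Q? xs)                                 ≡⟨ cong (c *_) (sym (count-∷ Q? x xs)) ⟩
    c * count Q? (x ∷ xs)                                          ∎
    where open ≤-Reasoning

  count-family-≥ : {Q : A → Set} (Q? : Decidable Q) →
                   (∀ x → ind (Q? x) ≤ sumTo t (λ i → ind (P? i x))) →
                   ∀ xs → count Q? xs ≤ sumTo t (λ i → count (P? i) xs)
  count-family-≥ Q? bound [] = z≤n
  count-family-≥ Q? bound (x ∷ xs) = begin
    count Q? (x ∷ xs)                                              ≡⟨ count-∷ Q? x xs ⟩
    ind (Q? x) + count Q? xs                                       ≤⟨ +-mono-≤ (bound x) (count-family-≥ Q? bound xs) ⟩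
    sumTo t (λ i → ind (P? i x)) + sumTo t (λ i → count (P? i) xs) ≡⟨ sym (sumTo-count-∷ x xs) ⟩
    sumTo t (λ i → count (P? i) (x ∷ xs))                         ∎
    where open ≤-Reasoning

locate : (b : ℕ → ℕ) (L : ℕ) → ∀ k → b 0 < L → L ≤ b k →
         Σ ℕ λ j → InRange k j × (b (j ∸ 1) < L) × (L ≤ b j)
locate b L zero    b0<L L≤b0 = ⊥-elim (<⇒≱ b0<L L≤b0)
locate b L (suc k) b0<L L≤bk+1 with L ≤? b k
... | yes L≤bk = let (j , (1≤j , j≤k) , lo , hi) = locate b L k b0<L L≤bk
                 in j , (1≤j , m≤n⇒m≤1+n j≤k) , lo , hi
... | no  L≰bk = suc k , (s≤s z≤n , ≤-refl) , ≰⇒> L≰bk , L≤bk+1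

locate-unique : (b : ℕ → ℕ) → (∀ {x y} → x ≤ y → b x ≤ b y) →
                ∀ {L i j} → b (i ∸ 1) < L → L ≤ b i → b (j ∸ 1) < L → L ≤ b j → i ≡ j
locate-unique b mono {i = i} {j} loᵢ hiᵢ loⱼ hiⱼ with <-cmp i j
... | tri< (s≤s i≤j-1) _ _ = ⊥-elim (<⇒≱ loⱼ (≤-trans hiᵢ (mono i≤j-1)))
... | tri≈ _ i≡j _         = i≡j
... | tri> _ _ (s≤s j≤i-1) = ⊥-elim (<⇒≱ loᵢ (≤-trans hiⱼ (mono j≤i-1)))

-- The bounds of C_j and D_a are written "x + 1 ≤ y"; locate speaks of "x < y".
<⇒+1≤ : ∀ {x y} → x < y → x + 1 ≤ y
<⇒+1≤ {x} {y} = subst (_≤ y) (+-comm 1 x)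

+1≤⇒< : ∀ {x y} → x + 1 ≤ y → x < y
+1≤⇒< {x} {y} = subst (_≤ y) (+-comm x 1)

n≤2^⌈log₂n⌉ : ∀ n → n ≤ 2 ^ ⌈log₂ n ⌉
n≤2^⌈log₂n⌉ n = bound n (<-wellFounded n)
  where
  n≤2⌈n/2⌉ : ∀ n → n ≤ ⌈ n /2⌉ + ⌈ n /2⌉
  n≤2⌈n/2⌉ n = subst (_≤ ⌈ n /2⌉ + ⌈ n /2⌉) (⌊n/2⌋+⌈n/2⌉≡n n) (+-monoˡ-≤ ⌈ n /2⌉ (⌊n/2⌋≤⌈n/2⌉ n))
  double-suc : ∀ x → 2 * suc x ≡ suc (suc (x + x))
  double-suc = solve-∀
  bound : ∀ n (rec : Acc _<_ n) → n ≤ 2 ^ ⌈log2⌉ n rec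
  bound 0 _ = z≤n
  bound 1 _ = ≤-refl
  bound (suc (suc n)) (acc rec) =
    ≤-trans (subst (suc (suc n) ≤_) (sym (double-suc ⌈ n /2⌉)) (s≤s (s≤s (n≤2⌈n/2⌉ n))))
            (*-monoʳ-≤ 2 (bound (suc ⌈ n /2⌉) _))

arc-len≥2 : {M : Set} {m : ℕ} (σ : Fin m → M) → ∀ {α} → IsArc σ α → 2 ≤ len σ α
arc-len≥2 σ {i , j} (i<j , _) =
  subst (2 ≤_) (sym (+-∸-assoc 1 (<⇒≤ i<j))) (s≤s (m<n⇒0<n∸m i<j))

len≤m : {M : Set} {m : ℕ} (σ : Fin m → M) → ∀ α → len σ α ≤ m
len≤m σ (i , j) = ≤-trans (m∸n≤m (suc (toℕ j)) (toℕ i)) (toℕ<n j)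

module Blocks {M : Set} (_≟_ : DecidableEquality M) {m : ℕ} (σ : Fin m → M)
              (s w t : ℕ) (s≤tw : s ≤ t * w) (m≤2^s : m ≤ 2 ^ s) where

  D : ℕ → Pair m → Set
  D = InD σ s w t

  C-unique : ∀ {j j' α} → InC σ s j α → InC σ s j' α → j ≡ j'
  C-unique (_ , _ , _ , lo , hi) (_ , _ , _ , lo' , hi') =
    locate-unique (2 ^_) (^-monoʳ-≤ 2) (+1≤⇒< lo) hi (+1≤⇒< lo') hi'

  D-unique : ∀ {a b α} → D a α → D b α → a ≡ b
  D-unique (_ , _ , j , lo , hi , c) (_ , _ , j' , lo' , hi' , c') with C-unique c c'
  ... | refl = locate-unique (_* w) (*-monoˡ-≤ w)
                 (+1≤⇒< lo) (≤-trans hi (m⊓n≤m _ _)) (+1≤⇒< lo') (≤-trans hi' (m⊓n≤m _ _))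

  D-arc : ∀ {a α} → D a α → IsArc σ α
  D-arc (_ , _ , _ , _ , _ , arc , _) = arc

  arc-in-D : ∀ {α} → IsArc σ α → Σ ℕ λ a → D a α
  arc-in-D {α} arc =
    let (j , (1≤j , j≤s) , loⱼ , hiⱼ) = locate (2 ^_) (len σ α) s (arc-len≥2 σ arc)
                                          (≤-trans (len≤m σ α) m≤2^s)
        (a , (1≤a , a≤t) , loₐ , hiₐ) = locate (_* w) j t 1≤j (≤-trans j≤s s≤tw)
    in a , 1≤a , a≤t , j , <⇒+1≤ loₐ , ⊓-glb hiₐ j≤s , arc , 1≤j , j≤s , <⇒+1≤ loⱼ , hiⱼ

  arc? : Decidable (IsArc σ)
  arc? = isArc? _≟_ σ

  D? : ∀ a → Decidable (D a)
  D? = inD? _≟_ σ s w t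

  goodIn? : ∀ a → Decidable (λ α → IsGoodArc σ w α × D a α)
  goodIn? a α = isGoodArc? _≟_ σ w α ×-dec D? a α

  near? : ∀ a → Decidable (λ α → D (a ∸ 1) α ⊎ (D a α ⊎ D (suc a) α))
  near? a α = D? (a ∸ 1) α ⊎-dec (D? a α ⊎-dec D? (suc a) α)

  -- Each arc lies in at most three neighbourhoods, one per shift of its block.
  near-bound : ∀ α → sumTo t (λ a → ind (near? a α)) ≤ 3 * ind (arc? α)
  near-bound α = begin
    sumTo t (λ a → ind (near? a α))
      ≤⟨ sumTo-mono t _ _ (λ a _ → ≤-trans (ind-⊎ (D? (a ∸ 1) α) _) (+-monoʳ-≤ _ (ind-⊎ (D? a α) _))) ⟩
    sumTo t (λ a → ind (D? (a ∸ 1) α) + (ind (D? a α) + ind (D? (suc a) α)))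
      ≡⟨ trans (sumTo-+ t (λ a → ind (D? (a ∸ 1) α)) _)
               (cong (sumTo t (λ a → ind (D? (a ∸ 1) α)) +_) (sumTo-+ t (λ a → ind (D? a α)) _)) ⟩
    sumTo t (λ a → ind (D? (a ∸ 1) α)) + (sumTo t (λ a → ind (D? a α)) + sumTo t (λ a → ind (D? (suc a) α)))
      ≤⟨ +-mono-≤ (at-most-once (_∸ 1) unique-prev)
                  (+-mono-≤ (at-most-once (λ a → a) (λ _ _ → D-unique))
                            (at-most-once suc (λ _ _ d d' → suc-injective (D-unique d d')))) ⟩
    ind (arc? α) + (ind (arc? α) + ind (arc? α))
      ≡⟨ cong (λ x → ind (arc? α) + (ind (arc? α) + x)) (sym (+-identityʳ _)) ⟩
    3 * ind (arc? α) ∎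
    where
    open ≤-Reasoning
    at-most-once : (shift : ℕ → ℕ) → (∀ a b → D (shift a) α → D (shift b) α → a ≡ b) →
                   sumTo t (λ a → ind (D? (shift a) α)) ≤ ind (arc? α)
    at-most-once shift unique = sumTo-ind-unique (arc? α) (λ a → D? (shift a) α) (λ _ → D-arc) unique t
    unique-prev : ∀ a b → D (a ∸ 1) α → D (b ∸ 1) α → a ≡ b
    unique-prev zero    _       (() , _) _
    unique-prev (suc a) zero    _        (() , _)
    unique-prev (suc a) (suc b) d d' = cong suc (D-unique d d')

  good-bound : ∀ α → ind (isGoodArc? _≟_ σ w α) ≤ sumTo t (λ a → ind (goodIn? a α))
  good-bound α = ind≤ (isGoodArc? _≟_ σ w α) λ good →
    let (a , d) = arc-in-D (proj₁ good)
    in ≤-trans (≤-reflexive (sym (ind-yes (goodIn? a α) (good , d))))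
               (term≤sumTo t (λ a → ind (goodIn? a α)) a (proj₁ d , proj₁ (proj₂ d)))

  pairs : List (Pair m)
  pairs = cartesianProduct (allFin m) (allFin m)

  near-total : sumTo t (λ a → card (near? a)) ≤ 3 * card arc?
  near-total = DoubleCounting.count-family-≤ near? t arc? 3 near-bound pairs

  good-total : card (isGoodArc? _≟_ σ w) ≤ sumTo t (λ a → card (goodIn? a))
  good-total = DoubleCounting.count-family-≥ goodIn? t (isGoodArc? _≟_ σ w) good-bound pairs

-- With f a = 7A + 2t · U a and
-- h a = 1 + 14t · g a we get Σ f ≤ 13tA ≤ 14tG < Σ h (as 1300 A ≤ 1386 A ≤
-- 1400 G), so f a < h a for some a, i.e. 7A + 2t · U a ≤ 14t · g a.
averaging : ∀ t A (g U : ℕ → ℕ) → 1 ≤ t → sumTo t U ≤ 3 * A → 99 * A ≤ 100 * sumTo t g →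
            Σ ℕ λ a → InRange t a × (A ≤ (2 * t) * g a) × (U a ≤ 7 * g a)
averaging zero        A g U ()
averaging t@(suc _) A g U _ ΣU≤3A 99A≤100G =
  let (a , a∈ , fa<ha) = sumTo-<-term t f h Σf<Σh
      fa≤14tga = ≤-pred fa<ha
  in a , a∈ , *-cancelˡ-≤ 7 (≤-trans (m≤m+n (7 * A) _) fa≤14tga)
            , *-cancelˡ-≤ (2 * t) (≤-trans (m≤n+m _ (7 * A))
                                  (≤-trans fa≤14tga (≤-reflexive (swap-factors t (g a)))))
  where
  G : ℕ
  G = sumTo t g
  f h : ℕ → ℕ
  f a = 7 * A + (2 * t) * U a
  h a = 1 + 7 * ((2 * t) * g a)

  swap-factors : ∀ t x → 7 * ((2 * t) * x) ≡ (2 * t) * (7 * x)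
  swap-factors = solve-∀
  seven-plus-six : ∀ t A → t * (7 * A) + (2 * t) * (3 * A) ≡ t * (13 * A)
  seven-plus-six = solve-∀
  fourteen : ∀ t G → t * (14 * G) ≡ 7 * ((2 * t) * G)
  fourteen = solve-∀
  hundreds : ∀ x → 14 * (100 * x) ≡ 100 * (14 * x)
  hundreds = solve-∀

  open ≤-Reasoning

  13A≤14G : 13 * A ≤ 14 * G
  13A≤14G = *-cancelˡ-≤ 100 (begin
    100 * (13 * A) ≡⟨ sym (*-assoc 100 13 A) ⟩
    1300 * A       ≤⟨ *-monoˡ-≤ A (m≤m+n 1300 86) ⟩
    1386 * A       ≡⟨ *-assoc 14 99 A ⟩
    14 * (99 * A)  ≤⟨ *-monoʳ-≤ 14 99A≤100G ⟩
    14 * (100 * G) ≡⟨ hundreds G ⟩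
    100 * (14 * G) ∎)

  Σf<Σh : sumTo t f < sumTo t h
  Σf<Σh = begin-strict
    sumTo t f                          ≡⟨ trans (sumTo-+ t (λ _ → 7 * A) _)
                                                (cong₂ _+_ (sumTo-const t (7 * A)) (sumTo-* t (2 * t) U)) ⟩
    t * (7 * A) + (2 * t) * sumTo t U  ≤⟨ +-monoʳ-≤ (t * (7 * A)) (*-monoʳ-≤ (2 * t) ΣU≤3A) ⟩
    t * (7 * A) + (2 * t) * (3 * A)    ≡⟨ seven-plus-six t A ⟩
    t * (13 * A)                       ≤⟨ *-monoʳ-≤ t 13A≤14G ⟩
    t * (14 * G)                       ≡⟨ fourteen t G ⟩
    7 * ((2 * t) * G)                  <⟨ m<n+m (7 * ((2 * t) * G)) {t * 1} (s≤s z≤n) ⟩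
    t * 1 + 7 * ((2 * t) * G)          ≡⟨ sym (trans (sumTo-+ t (λ _ → 1) _)
                                            (cong₂ _+_ (sumTo-const t 1)
                                                       (trans (sumTo-* t 7 _) (cong (7 *_) (sumTo-* t (2 * t) g))))) ⟩
    sumTo t h                          ∎

factor-pos : ∀ t w → 1 ≤ t * w → 1 ≤ t
factor-pos (suc _) _ _ = s≤s z≤n

-- The lemma: the blocks for s = ⌈log₂ 5n⌉ partition the arcs, and averaging
-- over them yields i*.
lemma4p8 : {M : Set} (_≟_ : DecidableEquality M)
           (n : ℕ) → 2 ≤ n →
           (σ : Fin (5 * n) → M) →
           (w : ℕ) → IsCeilSqrtLog n w →
           (t : ℕ) → IsCeilDiv ⌈log₂ (5 * n) ⌉ w t →
           99 * card (isArc? _≟_ σ) ≤ 100 * card (isGoodArc? _≟_ σ w) →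
           Σ ℕ (λ i* → (1 ≤ i*) × (i* ≤ t)
             × (card (isArc? _≟_ σ)
                  ≤ (2 * t) * card (λ α → isGoodArc? _≟_ σ w α ×-dec inD? _≟_ σ ⌈log₂ (5 * n) ⌉ w t i* α))
             × (card (λ α → inD? _≟_ σ ⌈log₂ (5 * n) ⌉ w t (i* ∸ 1) α
                              ⊎-dec (inD? _≟_ σ ⌈log₂ (5 * n) ⌉ w t i* α
                              ⊎-dec inD? _≟_ σ ⌈log₂ (5 * n) ⌉ w t (suc i*) α))
                  ≤ 7 * card (λ α → isGoodArc? _≟_ σ w α ×-dec inD? _≟_ σ ⌈log₂ (5 * n) ⌉ w t i* α)))
lemma4p8 _≟_ n 2≤n σ w _ t (s≤tw , _) 99A≤100Good =
  let (i* , (1≤i* , i*≤t) , heavy , dense) =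
        averaging t (card arc?) (λ a → card (goodIn? a)) (λ a → card (near? a)) 1≤t
                  near-total (≤-trans 99A≤100Good (*-monoʳ-≤ 100 good-total))
  in i* , 1≤i* , i*≤t , heavy , dense
  where
  s : ℕ
  s = ⌈log₂ (5 * n) ⌉
  open Blocks _≟_ σ s w t s≤tw (n≤2^⌈log₂n⌉ (5 * n))

  -- s ≥ ⌈log₂ 2⌉ = 1 since 5n ≥ 2, and s ≤ t w, so t ≥ 1.
  1≤t : 1 ≤ t
  1≤t = factor-pos t w (≤-trans (⌈log₂⌉-mono-≤ (≤-trans 2≤n (m≤m+n n (4 * n)))) s≤tw)
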